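{- Let $\Gamma$ be a finite, simple, connected cubic graph and let $G\leq\mathrm{Aut}(\Gamma)$ act transitively on the vertices of $\Gamma$ such that, for a vertex $v$, the permutation group induced by the stabiliser $G_v$ on the neighbourhood $\Gamma(v)$ is permutation isomorphic to the group of order $2$ acting on $3$ points (i.e. $(\Gamma,G)$ is locally-$\mathbb Z_2^{[3]}$). For each vertex $u$, let $u'$ be the unique neighbour of $u$ fixed by $G_u$, and let $\mathcal T=\{\{u,u'\}: u\in \mathrm V(\Gamma)\}$. Suppose that $(\Gamma,G)$ is degenerate, i.e. there exist elements $\{u,u'\}$ and $\{v,v'\}$ of $\mathcal T$ with more than one edge of $\Gamma$ joining a vertex of $\{u,u'\}$ to a vertex of $\{v,v'\}$. Then $\Gamma$ is either a circular ladder graph or a Möbius ladder graph.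
   Context: A circular ladder graph is a graph isomorphic to $\mathrm{Cay}(\mathbb Z_n\times\mathbb Z_2,\{(0,1),(1,0),(-1,0)\})$ for some $n\geq 3$. A Möbius ladder graph is a graph isomorphic to $\mathrm{Cay}(\mathbb Z_{2n},\{1,-1,n\})$ for some $n\geq 2$ (so the complete graph $K_4$ is a Möbius ladder). Here $\mathrm{Cay}(H,S)$ has vertex-set $H$ with $x\sim y$ iff $xy^{ -1}\in S$. In the locally-$\mathbb Z_2^{[3]}$ situation, $G_u$ fixes exactly one neighbour $u'$ of $u$, and $G_u=G_{u'}$, $u''=u$, so $\mathcal T$ is a perfect matching of $\Gamma$. -}

module Defs where

open import Level using (0ℓ)
open import Data.Nat using (ℕ; _*_)
open import Data.Fin using (Fin; toℕ)
open import Data.Fin.Permutation using (Permutation′; _⟨$⟩ʳ_; id; flip; _∘ₚ_)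
open import Data.Integer using (ℤ; +_; _-_; _+_)
open import Data.Integer.Divisibility using (_∣_)
open import Data.Product using (Σ; _×_; _,_; ∃; ∃-syntax)
open import Data.Sum using (_⊎_)
open import Data.Empty using (⊥)
open import Relation.Nullary using (¬_)
open import Relation.Binary.PropositionalEquality using (_≡_; _≢_)
open import Function.Bundles using (_⇔_; _↔_; Inverse)

record Graph : Set₁ where
  field
    N     : ℕ
    _~_   : Fin N → Fin N → Set
    sym   : ∀ {x y} → x ~ y → y ~ x
    irrefl : ∀ {x} → ¬ (x ~ x)

module _ (Γ : Graph) where
  open Graph Γ

  Cubic : Set
  Cubic = ∀ v → ∃[ a ] ∃[ b ] ∃[ c ]
            (v ~ a × v ~ b × v ~ c × a ≢ b × a ≢ c × b ≢ c ×
             (∀ w → v ~ w → w ≡ a ⊎ w ≡ b ⊎ w ≡ c))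

  data Walk : Fin N → Fin N → Set where
    here  : ∀ {x} → Walk x x
    step  : ∀ {x y z} → x ~ y → Walk y z → Walk x z

  Connected : Set
  Connected = ∀ x y → Walk x y

  IsAut : Permutation′ N → Set
  IsAut g = ∀ x y → (x ~ y) ⇔ ((g ⟨$⟩ʳ x) ~ (g ⟨$⟩ʳ y))

  record IsAutSubgroup (G : Permutation′ N → Set) : Set where
    field
      aut   : ∀ g → G g → IsAut g
      hasId : G id
      comp  : ∀ g h → G g → G h → G (g ∘ₚ h)
      inv   : ∀ g → G g → G (flip g)

  module _ (G : Permutation′ N → Set) where

    VertexTransitive : Set
    VertexTransitive = ∀ x y → ∃[ g ] (G g × g ⟨$⟩ʳ x ≡ y)

    InStab : Fin N → Permutation′ N → Set
    InStab v g = G g × g ⟨$⟩ʳ v ≡ v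

    -- The permutation group induced by G_v on Γ(v) is permutation
    -- isomorphic to Z₂ acting on 3 points: there is a bijection
    -- Γ(v) ≅ {a,b,c} under which the induced group is {1, (b c)}.
    LocalZ2on3At : Fin N → Set
    LocalZ2on3At v = ∃[ a ] ∃[ b ] ∃[ c ]
      ( v ~ a × v ~ b × v ~ c × a ≢ b × a ≢ c × b ≢ c
      × (∀ w → v ~ w → w ≡ a ⊎ w ≡ b ⊎ w ≡ c)
      × (∀ g → InStab v g →
           g ⟨$⟩ʳ a ≡ a ×
           ((g ⟨$⟩ʳ b ≡ b × g ⟨$⟩ʳ c ≡ c) ⊎ (g ⟨$⟩ʳ b ≡ c × g ⟨$⟩ʳ c ≡ b)))
      × (∃[ g ] (InStab v g × g ⟨$⟩ʳ b ≡ c × g ⟨$⟩ʳ c ≡ b)) )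

    LocallyZ2on3 : Set
    LocallyZ2on3 = ∃[ v ] LocalZ2on3At v

    -- u' is a neighbour of u fixed by G_u (it is unique in the
    -- locally-Z₂^[3] situation)
    FixedNbr : Fin N → Fin N → Set
    FixedNbr u u' = u ~ u' × (∀ g → InStab u g → g ⟨$⟩ʳ u' ≡ u')

    SameSet : Fin N → Fin N → Fin N → Fin N → Set
    SameSet x y z w = (x ≡ z × y ≡ w) ⊎ (x ≡ w × y ≡ z)

    InPair : Fin N → Fin N → Fin N → Set
    InPair x u u' = x ≡ u ⊎ x ≡ u'

    -- degenerate: two distinct elements {u,u'}, {v,v'} of 𝒯 joined by
    -- more than one edge (two distinct edges {x₁,y₁} ≠ {x₂,y₂})
    Degenerate : Set
    Degenerate = ∃[ u ] ∃[ u' ] ∃[ v ] ∃[ v' ]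
      ( FixedNbr u u' × FixedNbr v v' × ¬ SameSet u u' v v'
      × ∃[ x₁ ] ∃[ y₁ ] ∃[ x₂ ] ∃[ y₂ ]
          ( InPair x₁ u u' × InPair y₁ v v' × x₁ ~ y₁
          × InPair x₂ u u' × InPair y₂ v v' × x₂ ~ y₂
          × ¬ SameSet x₁ y₁ x₂ y₂ ) )

Isomorphic : (Γ : Graph) {V : Set} (_≈_ : V → V → Set) → Set
Isomorphic Γ {V} _≈_ =
  Σ (Fin (Graph.N Γ) ↔ V) λ f →
    ∀ x y → Graph._~_ Γ x y ⇔ (Inverse.to f x ≈ Inverse.to f y)

-- Cayley graphs: x ~ y iff x - y ∈ S (additive groups), with
-- congruence mod m expressed by divisibility in ℤ.

ι : ∀ {m} → Fin m → ℤ
ι i = + toℕ i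

-- Cay(ℤ_n × ℤ_2, {(0,1),(1,0),(-1,0)})
CircularLadderAdj : (n : ℕ) → Fin n × Fin 2 → Fin n × Fin 2 → Set
CircularLadderAdj n (i , a) (j , b) =
    ((+ n) ∣ (ι i - ι j)             × (+ 2) ∣ (ι a - ι b - + 1))
  ⊎ ((+ n) ∣ (ι i - ι j - + 1)       × (+ 2) ∣ (ι a - ι b))
  ⊎ ((+ n) ∣ (ι i - ι j + + 1)       × (+ 2) ∣ (ι a - ι b))

-- Cay(ℤ_{2n}, {1,-1,n})
MobiusLadderAdj : (n : ℕ) → Fin (2 * n) → Fin (2 * n) → Set
MobiusLadderAdj n x y =
    (+ (2 * n)) ∣ (ι x - ι y - + 1)
  ⊎ (+ (2 * n)) ∣ (ι x - ι y + + 1)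
  ⊎ (+ (2 * n)) ∣ (ι x - ι y - + n)

-- Write p u = u′ for the neighbour of u fixed by G_u.  Group theory
-- (module LocalAction) shows that p commutes with G and is a fixed-point
-- free involution, so 𝒯 is a perfect matching of rungs; degeneracy then
-- makes p map every other edge (rail) to an edge: the two edges between
-- the rungs form a triangle on a rung or a 4-cycle with them, and
-- vertex-transitivity spreads this local fact to all of Γ.
-- The rest is combinatorics (module Classification): the rails form a
-- 2-factor, a rail walk from v₀ first returns after L steps and lists a
-- cycle C without repetition, and since p is an automorphism either
-- p C ∩ C = ∅ and Γ = C ∪ p C is the circular ladder on ℤ_L × ℤ₂, or p
-- rotates C by L/2 and Γ = C is the Möbius ladder on ℤ_L.
module Submission where

open import Defs
open import Data.Nat using (ℕ; zero; suc; _+_; _*_; _∸_; _≤_; _<_; _<?_; z≤n; s≤s; s≤s⁻¹; NonZero; _%_; _/_)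
open import Data.Nat.Properties hiding (_≟_)
open import Data.Integer as ℤ using (+_)
open import Data.Integer.Divisibility using (_∣_)
open import Data.Fin using (Fin)
open import Data.Fin.Permutation using (Permutation′; _⟨$⟩ʳ_; _⟨$⟩ˡ_; flip; _∘ₚ_; inverseˡ; inverseʳ)
open import Data.Product using (_×_; _,_; proj₁; proj₂; ∃; ∃-syntax)
open import Data.Sum using (_⊎_; inj₁; inj₂; assocʳ; assocˡ) renaming (swap to ⊎-swap; map to ⊎-map)
open import Data.Empty using (⊥-elim)
open import Relation.Nullary using (¬_; Dec; yes; no; _×-dec_)
open import Function.Base using (_∘_; id)
open import Relation.Binary.PropositionalEquality
open import Function.Bundles using (_⇔_; mk⇔; Equivalence; mk↔ₛ′)
open import Function.Properties.Equivalence using () renaming (trans to ⇔-trans; sym to ⇔-sym)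
open import Data.Sum.Function.Propositional using (_⊎-⇔_)

module Congruence where
  open import Data.Integer.Properties using (m-n≡m⊖n; ⊖-≥; ∣i-j∣≡∣j-i∣; pos-+)
  import Data.Integer.Divisibility.Signed as Signed
  import Data.Nat.Divisibility as ℕ
  open import Data.Nat.DivMod using (m≡m%n+[m/n]*n; %-remove-+ˡ)
  open import Data.Integer.Tactic.RingSolver using (solve-∀)

  ∣difference⇔∣∸ : ∀ L {a b} → b ≤ a → (+ L ∣ + a ℤ.- + b) ⇔ (L ℕ.∣ a ∸ b)
  ∣difference⇔∣∸ L {a} {b} b≤a = mk⇔ (subst (L ℕ.∣_) distance) (subst (L ℕ.∣_) (sym distance))
    where
    distance : ℤ.∣ + a ℤ.- + b ∣ ≡ a ∸ b
    distance = cong ℤ.∣_∣ (trans (m-n≡m⊖n a b) (⊖-≥ b≤a))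

  ∣difference-sym : ∀ L a b → (+ L ∣ + a ℤ.- + b) ⇔ (+ L ∣ + b ℤ.- + a)
  ∣difference-sym L a b = mk⇔ (subst (L ℕ.∣_) (∣i-j∣≡∣j-i∣ (+ a) (+ b)))
                              (subst (L ℕ.∣_) (∣i-j∣≡∣j-i∣ (+ b) (+ a)))

  residues⇔∣∸ : ∀ L .{{_ : NonZero L}} {a b} → b ≤ a → (a % L ≡ b % L) ⇔ (L ℕ.∣ a ∸ b)
  residues⇔∣∸ L {a} {b} b≤a = mk⇔ to from
    where
    to : a % L ≡ b % L → L ℕ.∣ a ∸ b
    to same = ℕ.divides (a / L ∸ b / L) (begin
      a ∸ b
        ≡⟨ cong₂ _∸_ (m≡m%n+[m/n]*n a L) (m≡m%n+[m/n]*n b L) ⟩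
      (a % L + a / L * L) ∸ (b % L + b / L * L)
        ≡⟨ cong (λ r → (a % L + a / L * L) ∸ (r + b / L * L)) (sym same) ⟩
      (a % L + a / L * L) ∸ (a % L + b / L * L)
        ≡⟨ [m+n]∸[m+o]≡n∸o (a % L) _ _ ⟩
      a / L * L ∸ b / L * L
        ≡⟨ *-distribʳ-∸ L (a / L) (b / L) ⟨
      (a / L ∸ b / L) * L ∎)
      where open ≡-Reasoning
    from : L ℕ.∣ a ∸ b → a % L ≡ b % L
    from L∣a∸b = trans (cong (_% L) (sym (m∸n+n≡m b≤a))) (%-remove-+ˡ b L∣a∸b)

  residues⇔∣ : ∀ L .{{_ : NonZero L}} a b → (a % L ≡ b % L) ⇔ (+ L ∣ + a ℤ.- + b)
  residues⇔∣ L a b with ≤-total b a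
  ... | inj₁ b≤a = ⇔-trans (residues⇔∣∸ L b≤a) (⇔-sym (∣difference⇔∣∸ L b≤a))
  ... | inj₂ a≤b = ⇔-trans (mk⇔ sym sym)
                     (⇔-trans (residues⇔∣∸ L a≤b)
                       (⇔-trans (⇔-sym (∣difference⇔∣∸ L a≤b)) (∣difference-sym L b a)))

  ∣-shift : ∀ d x y → x ≡ y ℤ.+ + d → (+ d ∣ x) ⇔ (+ d ∣ y)
  ∣-shift d x y refl = mk⇔
    (λ d∣y+d → Signed.∣⇒∣ᵤ {+ d} {y}
                 (Signed.∣m+n∣n⇒∣m (Signed.∣ᵤ⇒∣ {+ d} {y ℤ.+ + d} d∣y+d) (Signed.∣-refl {+ d})))
    (λ d∣y → Signed.∣⇒∣ᵤ {+ d} {y ℤ.+ + d}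
               (Signed.∣m∣n⇒∣m+n (Signed.∣ᵤ⇒∣ {+ d} {y} d∣y) (Signed.∣-refl {+ d})))

  -- The three index shifts occurring in the ladder adjacencies:
  -- one step forward, one step back (= L − 1 steps forward), and the
  -- half turn i ↦ i + m on a cycle of length m + m.
  shift-forward : ∀ L i j → (+ L ∣ + suc i ℤ.- + j) ⇔ (+ L ∣ + i ℤ.- + j ℤ.+ + 1)
  shift-forward L i j = mk⇔ (subst (+ L ∣_) shifted) (subst (+ L ∣_) (sym shifted))
    where
    reorder : ∀ a b → (+ 1 ℤ.+ a) ℤ.- b ≡ a ℤ.- b ℤ.+ + 1
    reorder = solve-∀
    shifted : + suc i ℤ.- + j ≡ + i ℤ.- + j ℤ.+ + 1
    shifted = trans (cong (ℤ._- + j) (pos-+ 1 i)) (reorder (+ i) (+ j))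

  shift-back : ∀ L′ i j → (+ suc L′ ∣ + (i + L′) ℤ.- + j) ⇔ (+ suc L′ ∣ + i ℤ.- + j ℤ.- + 1)
  shift-back L′ i j = ∣-shift (suc L′) _ (+ i ℤ.- + j ℤ.- + 1) shifted
    where
    reorder : ∀ a b l → (a ℤ.+ l) ℤ.- b ≡ a ℤ.- b ℤ.- + 1 ℤ.+ (+ 1 ℤ.+ l)
    reorder = solve-∀
    shifted : + (i + L′) ℤ.- + j ≡ + i ℤ.- + j ℤ.- + 1 ℤ.+ + suc L′
    shifted = trans (cong (ℤ._- + j) (pos-+ i L′))
                (trans (reorder (+ i) (+ j) (+ L′))
                       (cong (λ z → + i ℤ.- + j ℤ.- + 1 ℤ.+ z) (sym (pos-+ 1 L′))))

  shift-half : ∀ {L} m → L ≡ m + m → ∀ i j → (+ L ∣ + (i + m) ℤ.- + j) ⇔ (+ L ∣ + i ℤ.- + j ℤ.- + m)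
  shift-half m refl i j = ∣-shift (m + m) _ (+ i ℤ.- + j ℤ.- + m) shifted
    where
    reorder : ∀ a b l → (a ℤ.+ l) ℤ.- b ≡ a ℤ.- b ℤ.- l ℤ.+ (l ℤ.+ l)
    reorder = solve-∀
    shifted : + (i + m) ℤ.- + j ≡ + i ℤ.- + j ℤ.- + m ℤ.+ + (m + m)
    shifted = trans (cong (ℤ._- + j) (pos-+ i m))
                (trans (reorder (+ i) (+ j) (+ m))
                       (cong (λ z → + i ℤ.- + j ℤ.- + m ℤ.+ z) (sym (pos-+ m m))))

  2∤1 : ¬ (+ 2 ∣ + 1)
  2∤1 2∣1 with ℕ.∣1⇒≡1 2∣1
  ... | ()

  2∣0 : + 2 ∣ + 0
  2∣0 = 2 ℕ.∣0

  2∣2 : + 2 ∣ + 2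
  2∣2 = ℕ.∣-refl

open Congruence

even-or-odd : ∀ n → (∃ λ e → n ≡ e + e) ⊎ (∃ λ e → n ≡ suc (e + e))
even-or-odd zero = inj₁ (0 , refl)
even-or-odd (suc n) with even-or-odd n
... | inj₁ (e , n≡e+e)   = inj₂ (e , cong suc n≡e+e)
... | inj₂ (e , n≡1+e+e) = inj₁ (suc e , cong suc (trans n≡1+e+e (sym (+-suc e e))))

half-of-3≤ : ∀ m → 3 ≤ m + m → 2 ≤ m
half-of-3≤ (suc (suc m)) _ = s≤s (s≤s z≤n)
half-of-3≤ (suc zero) (s≤s (s≤s ()))
half-of-3≤ zero ()

least-witness : (P : ℕ → Set) → (∀ n → Dec (P n)) → ∀ {n} → P n →
                ∃ λ m → P m × (∀ k → k < m → ¬ P k)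
least-witness P P? {n} pₙ with search (suc n)
  where
  search : ∀ b → (∀ k → k < b → ¬ P k) ⊎ (∃ λ m → P m × (∀ k → k < m → ¬ P k))
  search zero = inj₁ (λ _ ())
  search (suc b) with search b
  ... | inj₂ found = inj₂ found
  ... | inj₁ none with P? b
  ...   | yes holds = inj₂ (b , holds , none)
  ...   | no  fails = inj₁ below
    where
    below : ∀ k → k < suc b → ¬ P k
    below k k<1+b with m≤n⇒m<n∨m≡n (s≤s⁻¹ k<1+b)
    ... | inj₁ k<b  = none k k<b
    ... | inj₂ refl = fails
... | inj₁ none  = ⊥-elim (none n ≤-refl pₙ)
... | inj₂ found = found

labelling⇒iso : (Γ : Graph) {B : Set} (R : B → B → Set)
                (label : B → Fin (Graph.N Γ)) (index : Fin (Graph.N Γ) → B) →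
                (∀ y → label (index y) ≡ y) → (∀ b → index (label b) ≡ b) →
                (∀ a b → Graph._~_ Γ (label a) (label b) ⇔ R a b) → Isomorphic Γ R
labelling⇒iso Γ R label index label∘index index∘label adjacency =
  mk↔ₛ′ index label index∘label label∘index , λ x y → mk⇔
    (λ x~y → Equivalence.to (adjacency (index x) (index y))
               (subst₂ _~_ (sym (label∘index x)) (sym (label∘index y)) x~y))
    (λ r → subst₂ _~_ (label∘index x) (label∘index y)
             (Equivalence.from (adjacency (index x) (index y)) r))
  where open Graph Γ using (_~_)

rotate-⊎ : ∀ {A B C : Set} → (C ⊎ A ⊎ B) ⇔ (A ⊎ B ⊎ C)
rotate-⊎ = mk⇔ (assocʳ ∘ ⊎-swap) (⊎-swap ∘ assocˡ)

-- In the circular ladder the rung disjunct requires the levels to differ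
-- (X: a − b odd), the rail disjuncts require them to agree (Y: a − b even).
rails-only : ∀ {P Q R X Y : Set} → ¬ X → Y → ((P × X) ⊎ (Q × Y) ⊎ (R × Y)) ⇔ (Q ⊎ R)
rails-only {P} {Q} {R} {X} {Y} ¬x y = mk⇔ to from
  where
  to : (P × X) ⊎ (Q × Y) ⊎ (R × Y) → Q ⊎ R
  to (inj₁ (_ , x))        = ⊥-elim (¬x x)
  to (inj₂ (inj₁ (q , _))) = inj₁ q
  to (inj₂ (inj₂ (r , _))) = inj₂ r
  from : Q ⊎ R → (P × X) ⊎ (Q × Y) ⊎ (R × Y)
  from (inj₁ q) = inj₂ (inj₁ (q , y))
  from (inj₂ r) = inj₂ (inj₂ (r , y))

rung-only : ∀ {P Q R X Y : Set} → X → ¬ Y → ((P × X) ⊎ (Q × Y) ⊎ (R × Y)) ⇔ P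
rung-only {P} {Q} {R} {X} {Y} x ¬y = mk⇔ to (λ q → inj₁ (q , x))
  where
  to : (P × X) ⊎ (Q × Y) ⊎ (R × Y) → P
  to (inj₁ (q , _))        = q
  to (inj₂ (inj₁ (_ , y))) = ⊥-elim (¬y y)
  to (inj₂ (inj₂ (_ , y))) = ⊥-elim (¬y y)

-- Cay(ℤ_L, {1, −1, m}) on Fin L; for L = 2m this is the Möbius ladder.
HalfTurnAdj : (L m : ℕ) → Fin L → Fin L → Set
HalfTurnAdj L m x y =
    (+ L ∣ ι x ℤ.- ι y ℤ.- + 1)
  ⊎ (+ L ∣ ι x ℤ.- ι y ℤ.+ + 1)
  ⊎ (+ L ∣ ι x ℤ.- ι y ℤ.- + m)

-- The combinatorial shape of the locally-ℤ₂^[3] situation: a perfect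
-- matching x ↦ p x of Γ (the rungs) and the two remaining neighbours
-- r₁ x, r₂ x of each vertex.
record RungMatching (Γ : Graph) : Set where
  open Graph Γ
  field
    p            : Fin N → Fin N
    p-involutive : ∀ x → p (p x) ≡ x
    x~px         : ∀ x → x ~ p x
    r₁ r₂        : Fin N → Fin N
    x~r₁x        : ∀ x → x ~ r₁ x
    x~r₂x        : ∀ x → x ~ r₂ x
    r₁≢r₂        : ∀ x → r₁ x ≢ r₂ x
    r₁≢p         : ∀ x → r₁ x ≢ p x
    r₂≢p         : ∀ x → r₂ x ≢ p x
    neighbours   : ∀ x y → x ~ y → y ≡ p x ⊎ y ≡ r₁ x ⊎ y ≡ r₂ x

module Rails (Γ : Graph) (M : RungMatching Γ) where
  open Graph Γ renaming (sym to ~-sym)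
  open RungMatching M
  open import Data.Fin using (_≟_)

  V : Set
  V = Fin N

  Rail : V → V → Set
  Rail x y = x ~ y × y ≢ p x

  rail-cases : ∀ {x y} → Rail x y → y ≡ r₁ x ⊎ y ≡ r₂ x
  rail-cases {x} {y} (x~y , y≢px) with neighbours x y x~y
  ... | inj₁ y≡px = ⊥-elim (y≢px y≡px)
  ... | inj₂ y≡rₓ = y≡rₓ

  r₁-rail : ∀ x → Rail x (r₁ x)
  r₁-rail x = x~r₁x x , r₁≢p x

  r₂-rail : ∀ x → Rail x (r₂ x)
  r₂-rail x = x~r₂x x , r₂≢p x

  p-injective : ∀ {x y} → p x ≡ p y → x ≡ y
  p-injective {x} {y} px≡py = trans (sym (p-involutive x)) (trans (cong p px≡py) (p-involutive y))

  p-no-fixed-point : ∀ x → p x ≢ x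
  p-no-fixed-point x px≡x = irrefl (subst (x ~_) px≡x (x~px x))

  rail-sym : ∀ {x y} → Rail x y → Rail y x
  rail-sym {x} {y} (x~y , y≢px) =
    ~-sym x~y , λ x≡py → y≢px (trans (sym (p-involutive y)) (cong p (sym x≡py)))

  rail-irrefl : ∀ {x y} → Rail x y → x ≢ y
  rail-irrefl (x~x , _) refl = irrefl x~x

  other : V → V → V
  other x y with y ≟ r₁ x
  ... | yes _ = r₂ x
  ... | no  _ = r₁ x

  other-rail : ∀ x y → Rail x (other x y)
  other-rail x y with y ≟ r₁ x
  ... | yes _ = r₂-rail x
  ... | no  _ = r₁-rail x

  other-≢ : ∀ x y → other x y ≢ y
  other-≢ x y with y ≟ r₁ x
  ... | yes y≡r₁ = λ r₂≡y → r₁≢r₂ x (trans (sym y≡r₁) (sym r₂≡y))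
  ... | no  y≢r₁ = λ r₁≡y → y≢r₁ (sym r₁≡y)

  other-unique : ∀ {x y z} → Rail x y → Rail x z → z ≢ y → z ≡ other x y
  other-unique {x} {y} {z} rail-y rail-z z≢y with y ≟ r₁ x | rail-cases rail-y | rail-cases rail-z
  ... | yes y≡r₁ | _          | inj₁ z≡r₁ = ⊥-elim (z≢y (trans z≡r₁ (sym y≡r₁)))
  ... | yes _    | _          | inj₂ z≡r₂ = z≡r₂
  ... | no  y≢r₁ | inj₁ y≡r₁  | _         = ⊥-elim (y≢r₁ y≡r₁)
  ... | no  _    | inj₂ _     | inj₁ z≡r₁ = z≡r₁
  ... | no  _    | inj₂ y≡r₂  | inj₂ z≡r₂ = ⊥-elim (z≢y (trans z≡r₂ (sym y≡r₂)))

  rail-two : ∀ {x y z w} → Rail x y → Rail x z → y ≢ z → Rail x w → w ≡ y ⊎ w ≡ z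
  rail-two {y = y} {w = w} rail-y rail-z y≢z rail-w with w ≟ y
  ... | yes w≡y = inj₁ w≡y
  ... | no  w≢y = inj₂ (trans (other-unique rail-y rail-w w≢y)
                              (sym (other-unique rail-y rail-z (λ z≡y → y≢z (sym z≡y)))))

  -- p maps rails to edges; this makes p an automorphism of Γ.
  PreservesRails : Set
  PreservesRails = ∀ {x y} → Rail x y → p x ~ p y

module Classification (Γ : Graph) (M : RungMatching Γ) (p-on-rails : Rails.PreservesRails Γ M)
                      (connected : Connected Γ) (v₀ : Fin (Graph.N Γ)) where
  open Graph Γ renaming (sym to ~-sym)
  open RungMatching M
  open Rails Γ M
  open import Data.Fin using (toℕ; fromℕ<; _≟_; combine)
  open import Data.Fin.Patterns using (0F; 1F)
  import Data.Fin.Properties as Fin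
  open import Data.Nat.Tactic.RingSolver using (solve-∀)
  open import Data.Nat.DivMod using (m%n<n; m≡m%n+[m/n]*n)
  open import Relation.Binary.Definitions using (tri<; tri≈; tri>)

  spread : (P : V → Set) → P v₀ → (∀ x y → P x → x ~ y → P y) → ∀ y → P y
  spread P p₀ closed y = along (connected v₀ y) p₀
    where
    along : ∀ {x y} → Walk Γ x y → P x → P y
    along here          pₓ = pₓ
    along (step x~z w) pₓ = along w (closed _ _ pₓ x~z)

  rail-p : ∀ {x y} → Rail x y → Rail (p x) (p y)
  rail-p {x} {y} (x~y , y≢px) = p-on-rails (x~y , y≢px) , λ py≡ppx → y≢px (p-injective py≡ppx)

  p-adjacent : ∀ {x y} → x ~ y → p x ~ p y
  p-adjacent {x} {y} x~y with y ≟ p x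
  ... | yes refl = subst (p x ~_) (sym (p-involutive x)) (~-sym (x~px x))
  ... | no y≢px  = p-on-rails (x~y , y≢px)

  IsWalk : (ℕ → V) → Set
  IsWalk w = ∀ k → Rail (w k) (w (suc k)) × w (suc (suc k)) ≢ w k

  shift-walk : ∀ {w} m → IsWalk w → IsWalk (λ k → w (k + m))
  shift-walk m walk k = walk (k + m)

  p-walk : ∀ {w} → IsWalk w → IsWalk (λ k → p (w k))
  p-walk walk k = rail-p (proj₁ (walk k)) , λ e → proj₂ (walk k) (p-injective e)

  walk-next : ∀ {w} → IsWalk w → ∀ k → w (suc (suc k)) ≡ other (w (suc k)) (w k)
  walk-next walk k = other-unique (rail-sym (proj₁ (walk k))) (proj₁ (walk (suc k))) (proj₂ (walk k))

  walk-prev : ∀ {w} → IsWalk w → ∀ k → w k ≡ other (w (suc k)) (w (suc (suc k)))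
  walk-prev walk k = other-unique (proj₁ (walk (suc k))) (rail-sym (proj₁ (walk k)))
                       (λ e → proj₂ (walk k) (sym e))

  agree-forward : ∀ {u w} → IsWalk u → IsWalk w → u 0 ≡ w 0 → u 1 ≡ w 1 → ∀ k → u k ≡ w k
  agree-forward {u} {w} walk-u walk-w e₀ e₁ k = proj₁ (pairs k)
    where
    pairs : ∀ k → u k ≡ w k × u (suc k) ≡ w (suc k)
    pairs zero = e₀ , e₁
    pairs (suc k) with pairs k
    ... | eₖ , eₖ₊₁ = eₖ₊₁ , trans (walk-next walk-u k)
                               (trans (cong₂ other eₖ₊₁ eₖ) (sym (walk-next walk-w k)))

  agree-backward : ∀ {u w} → IsWalk u → IsWalk w → ∀ i → u i ≡ w i → u (suc i) ≡ w (suc i) →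
                   u 0 ≡ w 0 × u 1 ≡ w 1
  agree-backward walk-u walk-w zero eᵢ eᵢ₊₁ = eᵢ , eᵢ₊₁
  agree-backward walk-u walk-w (suc i) eᵢ eᵢ₊₁ =
    agree-backward walk-u walk-w i
      (trans (walk-prev walk-u i) (trans (cong₂ other eᵢ eᵢ₊₁) (sym (walk-prev walk-w i)))) eᵢ

  agree-reversed : ∀ {u w} → IsWalk u → IsWalk w → ∀ n → u 0 ≡ w (suc n) → u 1 ≡ w n →
                   ∀ k l → k + l ≡ suc n → u k ≡ w l
  agree-reversed {u} {w} walk-u walk-w n e₀ e₁ = agree
    where
    pairs : ∀ k l → k + l ≡ n → u k ≡ w (suc l) × u (suc k) ≡ w l
    pairs zero l refl = e₀ , e₁
    pairs (suc k) l k+l≡n with pairs k (suc l) (trans (+-suc k l) k+l≡n)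
    ... | eₖ , eₖ₊₁ = eₖ₊₁ , trans (walk-next walk-u k)
                               (trans (cong₂ other eₖ₊₁ eₖ) (sym (walk-prev walk-w l)))
    agree : ∀ k l → k + l ≡ suc n → u k ≡ w l
    agree k (suc l) k+l≡1+n = proj₁ (pairs k l (suc-injective (trans (sym (+-suc k l)) k+l≡1+n)))
    agree (suc k) zero k+0≡1+n = proj₂ (pairs k zero (suc-injective k+0≡1+n))

  -- A rail walk is never symmetric about a point beyond its start:
  -- at the middle it would either stand still or turn back.
  no-self-reflection : ∀ {w} → IsWalk w → ∀ j D → ¬ (∀ k l → k + l ≡ j + suc D → w (k + j) ≡ w l)
  no-self-reflection {w} walk j D mirror with even-or-odd D
  ... | inj₁ (e , D≡e+e) =
    rail-irrefl (proj₁ (walk (e + j)))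
      (mirror e (suc (e + j)) (trans (middle e j) (cong (λ d → j + suc d) (sym D≡e+e))))
    where
    middle : ∀ e j → e + suc (e + j) ≡ j + suc (e + e)
    middle = solve-∀
  ... | inj₂ (e , D≡1+e+e) =
    proj₂ (walk (e + j))
      (sym (mirror e (suc (suc (e + j))) (trans (middle e j) (cong (λ d → j + suc d) (sym D≡1+e+e)))))
    where
    middle : ∀ e j → e + suc (suc (e + j)) ≡ j + suc (suc (e + e))
    middle = solve-∀

  -- Nor can p reflect a rail walk onto itself: at the middle p would fix
  -- a vertex or send it to a rail neighbour.
  no-partner-reflection : ∀ {w} → IsWalk w → ∀ c → ¬ (∀ k l → k + l ≡ c → p (w k) ≡ w l)
  no-partner-reflection {w} walk c mirror with even-or-odd c
  ... | inj₁ (e , c≡e+e)   = p-no-fixed-point (w e) (mirror e e (sym c≡e+e))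
  ... | inj₂ (e , c≡1+e+e) = proj₂ (proj₁ (walk e)) (sym (mirror e (suc e) (trans (+-suc e e) (sym c≡1+e+e))))

  s : ℕ → V
  s zero          = v₀
  s (suc zero)    = r₁ v₀
  s (suc (suc k)) = other (s (suc k)) (s k)

  s-walk : IsWalk s
  s-walk k = s-rail k , other-≢ (s (suc k)) (s k)
    where
    s-rail : ∀ k → Rail (s k) (s (suc k))
    s-rail zero    = r₁-rail v₀
    s-rail (suc k) = other-rail (s (suc k)) (s k)

  Returns : ℕ → Set
  Returns m = 0 < m × s m ≡ s 0 × s (suc m) ≡ s 1

  returns? : ∀ m → Dec (Returns m)
  returns? m = (0 <? m) ×-dec (s m ≟ s 0) ×-dec (s (suc m) ≟ s 1)

  Period : ℕ → Set
  Period P = ∀ k → s (k + P) ≡ s k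

  returns⇒period : ∀ {m} → Returns m → Period m
  returns⇒period {m} (_ , eₘ , eₘ₊₁) = agree-forward (shift-walk m s-walk) s-walk eₘ eₘ₊₁

  -- A repeated rail edge makes s return: walks are determined backwards.
  repeat⇒returns : ∀ {i j} → i < j → s i ≡ s j → s (suc i) ≡ s (suc j) → Returns (j ∸ i)
  repeat⇒returns {i} {j} i<j eᵢ eᵢ₊₁ with agree-backward s-walk (shift-walk (j ∸ i) s-walk) i
      (trans eᵢ (cong s j≡i+P)) (trans eᵢ₊₁ (cong (s ∘ suc) j≡i+P))
    where
    j≡i+P : j ≡ i + (j ∸ i)
    j≡i+P = sym (m+[n∸m]≡n (<⇒≤ i<j))
  ... | e₀ , e₁ = m<n⇒0<n∸m i<j , sym e₀ , sym e₁

  -- By finiteness some rail edge repeats, so s returns; take the first return.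
  first-return : ∃ λ L → Returns L × (∀ k → k < L → ¬ Returns k)
  first-return with Fin.pigeonhole (n<1+n (N * N)) (λ k → combine (s (toℕ k)) (s (suc (toℕ k))))
  ... | i , j , i<j , same-edge with Fin.combine-injective _ _ _ _ same-edge
  ...   | eᵢ , eᵢ₊₁ = least-witness Returns returns? (repeat⇒returns i<j eᵢ eᵢ₊₁)

  returns⇒3≤ : ∀ {m} → Returns m → 3 ≤ m
  returns⇒3≤ {suc zero}          (_ , e₁ , _) = ⊥-elim (rail-irrefl (proj₁ (s-walk 0)) (sym e₁))
  returns⇒3≤ {suc (suc zero)}    (_ , e₂ , _) = ⊥-elim (proj₂ (s-walk 0) e₂)
  returns⇒3≤ {suc (suc (suc m))} _            = s≤s (s≤s (s≤s z≤n))

  -- The cycle C = {s 0, …, s (L − 1)}, L = 1 + L′ the first return.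
  module Cycle (L′ : ℕ) (returns : Returns (suc L′)) (first : ∀ k → k < suc L′ → ¬ Returns k) where
    L : ℕ
    L = suc L′

    period : Period L
    period = returns⇒period returns

    s-pred : ∀ i → s (suc (i + L′)) ≡ s i
    s-pred i = trans (cong s (sym (+-suc i L′))) (period i)

    rail-back : ∀ i → Rail (s i) (s (i + L′))
    rail-back i = subst (λ x → Rail x (s (i + L′))) (s-pred i) (rail-sym (proj₁ (s-walk (i + L′))))

    back≢forward : ∀ i → s (i + L′) ≢ s (suc i)
    back≢forward i back≡forward =
      proj₂ (s-walk (i + L′)) (trans (trans (cong s (cong suc (sym (+-suc i L′)))) (period (suc i)))
                                     (sym back≡forward))

    -- The rail neighbours of s i are s (i + 1) and s (i − 1) = s (i + L′).
    rail-nbrs : ∀ i {y} → Rail (s i) y → y ≡ s (suc i) ⊎ y ≡ s (i + L′)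
    rail-nbrs i = rail-two (proj₁ (s-walk i)) (rail-back i) (λ e → back≢forward i (sym e))

    reflection : ∀ {i j} → j < L → s i ≡ s j → s (suc i) ≢ s (suc j) →
                 ∀ k l → k + l ≡ suc (i + L′) → s (k + j) ≡ s l
    reflection {i} {j} j<L sᵢ≡sⱼ different = agree-reversed (shift-walk j s-walk) s-walk (i + L′)
      (trans (sym sᵢ≡sⱼ) (sym (s-pred i))) back-exit
      where
      back-exit : s (suc j) ≡ s (i + L′)
      back-exit with rail-nbrs i (subst (λ x → Rail x (s (suc j))) (sym sᵢ≡sⱼ) (proj₁ (s-walk j)))
      ... | inj₁ forward = ⊥-elim (different (sym forward))
      ... | inj₂ back    = back

    -- s is injective on one period: a repeat in the same direction would be
    -- an earlier return, in the opposite direction a reflection.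
    no-repeat : ∀ {i j} → i < j → j < L → s i ≢ s j
    no-repeat {i} {j} i<j j<L sᵢ≡sⱼ with s (suc i) ≟ s (suc j)
    ... | yes same = first (j ∸ i) (≤-<-trans (m∸n≤m j i) j<L) (repeat⇒returns i<j sᵢ≡sⱼ same)
    ... | no different = no-self-reflection s-walk j (i + L′ ∸ j)
          (λ k l k+l≡ → reflection j<L sᵢ≡sⱼ different k l
                          (trans k+l≡ (trans (+-suc j _) (cong suc (m+[n∸m]≡n j≤i+L′)))))
      where
      j≤i+L′ : j ≤ i + L′
      j≤i+L′ = ≤-trans (s≤s⁻¹ j<L) (m≤n+m L′ i)

    injective : ∀ {i j} → i < L → j < L → s i ≡ s j → i ≡ j
    injective {i} {j} i<L j<L sᵢ≡sⱼ with <-cmp i j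
    ... | tri< i<j _ _ = ⊥-elim (no-repeat i<j j<L sᵢ≡sⱼ)
    ... | tri≈ _ i≡j _ = i≡j
    ... | tri> _ _ j<i = ⊥-elim (no-repeat j<i i<L (sym sᵢ≡sⱼ))

    s-mod : ∀ j → s (j % L) ≡ s j
    s-mod j = trans (sym (period-multiple (j % L) (j / L))) (cong s (sym (m≡m%n+[m/n]*n j L)))
      where
      period-multiple : ∀ r q → s (r + q * L) ≡ s r
      period-multiple r zero    = cong s (+-identityʳ r)
      period-multiple r (suc q) = trans (cong s (shuffle r q L)) (trans (period (r + q * L)) (period-multiple r q))
        where
        shuffle : ∀ r q L → r + (L + q * L) ≡ (r + q * L) + L
        shuffle = solve-∀

    s-equal⇔ : ∀ a b → (s a ≡ s b) ⇔ (+ L ∣ + a ℤ.- + b)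
    s-equal⇔ a b = ⇔-trans
      (mk⇔ (λ same-vertex → injective (m%n<n a L) (m%n<n b L) (trans (s-mod a) (trans same-vertex (sym (s-mod b)))))
           (λ same → trans (sym (s-mod a)) (trans (cong s same) (s-mod b))))
      (residues⇔∣ L a b)

    position : ℕ → Fin L
    position j = fromℕ< (m%n<n j L)

    s-position : ∀ j → s (toℕ (position j)) ≡ s j
    s-position j = trans (cong s (Fin.toℕ-fromℕ< (m%n<n j L))) (s-mod j)

    position-unique : ∀ j (i : Fin L) → s j ≡ s (toℕ i) → position j ≡ i
    position-unique j i sⱼ≡sᵢ = Fin.toℕ-injective
      (injective (Fin.toℕ<n (position j)) (Fin.toℕ<n i) (trans (s-position j) sⱼ≡sᵢ))

    OnCycle : V → Set
    OnCycle y = ∃ λ j → y ≡ s j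

    on-cycle-rail : ∀ {y z} → OnCycle y → Rail y z → OnCycle z
    on-cycle-rail (j , refl) rail with rail-nbrs j rail
    ... | inj₁ forward = suc j , forward
    ... | inj₂ back    = j + L′ , back

    cycle-nbrs : ∀ i y → (s i ~ y) ⇔ (y ≡ p (s i) ⊎ y ≡ s (i + L′) ⊎ y ≡ s (suc i))
    cycle-nbrs i y = mk⇔ to from
      where
      to : s i ~ y → y ≡ p (s i) ⊎ y ≡ s (i + L′) ⊎ y ≡ s (suc i)
      to sᵢ~y with y ≟ p (s i)
      ... | yes rung = inj₁ rung
      ... | no  y≢p with rail-nbrs i (sᵢ~y , y≢p)
      ...   | inj₁ forward = inj₂ (inj₂ forward)
      ...   | inj₂ back    = inj₂ (inj₁ back)
      from : y ≡ p (s i) ⊎ y ≡ s (i + L′) ⊎ y ≡ s (suc i) → s i ~ y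
      from (inj₁ refl)        = x~px (s i)
      from (inj₂ (inj₁ refl)) = proj₁ (rail-back i)
      from (inj₂ (inj₂ refl)) = proj₁ (proj₁ (s-walk i))

    is-back⇔ : ∀ i j → (s j ≡ s (i + L′)) ⇔ (+ L ∣ + i ℤ.- + j ℤ.- + 1)
    is-back⇔ i j = ⇔-trans (mk⇔ sym sym) (⇔-trans (s-equal⇔ (i + L′) j) (shift-back L′ i j))

    is-forward⇔ : ∀ i j → (s j ≡ s (suc i)) ⇔ (+ L ∣ + i ℤ.- + j ℤ.+ + 1)
    is-forward⇔ i j = ⇔-trans (mk⇔ sym sym) (⇔-trans (s-equal⇔ (suc i) j) (shift-forward L i j))

    cycle-adjacency : ∀ i j → (s i ~ s j) ⇔
      (s j ≡ p (s i) ⊎ (+ L ∣ + i ℤ.- + j ℤ.- + 1) ⊎ (+ L ∣ + i ℤ.- + j ℤ.+ + 1))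
    cycle-adjacency i j = ⇔-trans (cycle-nbrs i (s j)) (mk⇔ id id ⊎-⇔ (is-back⇔ i j ⊎-⇔ is-forward⇔ i j))

    data PartnerAction : Set where
      off-cycle : (∀ k j → p (s k) ≢ s j) → PartnerAction
      half-turn : ∀ m → L ≡ m + m → (∀ k → p (s k) ≡ s (k + m)) → PartnerAction

    -- A rotation by m with p (p x) = x forces 2m = L.
    rotation-by-half : ∀ m → m < L → 0 < m → s (m + m) ≡ s 0 → L ≡ m + m
    rotation-by-half m m<L 0<m s₂ₘ≡s₀ with <-cmp (m + m) L
    ... | tri< 2m<L _ _ = ⊥-elim (<⇒≢ 0<m (sym (m+n≡0⇒m≡0 m (injective 2m<L (s≤s z≤n) s₂ₘ≡s₀))))
    ... | tri≈ _ 2m≡L _ = sym 2m≡L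
    ... | tri> _ _ L<2m = ⊥-elim (<⇒≢ (m<n⇒0<n∸m L<2m) (sym (injective excess<L (s≤s z≤n) s-excess)))
      where
      excess<L : m + m ∸ L < L
      excess<L = subst (m + m ∸ L <_) (m+n∸n≡m L L) (∸-monoˡ-< (+-mono-< m<L m<L) (<⇒≤ L<2m))
      s-excess : s (m + m ∸ L) ≡ s 0
      s-excess = trans (sym (period (m + m ∸ L))) (trans (cong s (m∸n+n≡m (<⇒≤ L<2m))) s₂ₘ≡s₀)

    partner-action : PartnerAction
    partner-action with Fin.any? (λ (j : Fin L) → p (s 0) ≟ s (toℕ j))
    ... | yes (j , p₀≡sₘ) = on-cycle (toℕ j) (Fin.toℕ<n j) p₀≡sₘ
      where
      on-cycle : ∀ m → m < L → p (s 0) ≡ s m → PartnerAction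
      on-cycle m m<L p₀≡sₘ
        with rail-nbrs m (subst (λ x → Rail x (p (s 1))) p₀≡sₘ (rail-p (proj₁ (s-walk 0))))
      ... | inj₁ p₁≡sₘ₊₁ = half-turn m (rotation-by-half m m<L 0<m s₂ₘ≡s₀) rotation
        where
        rotation : ∀ k → p (s k) ≡ s (k + m)
        rotation = agree-forward (p-walk s-walk) (shift-walk m s-walk) p₀≡sₘ p₁≡sₘ₊₁
        0<m : 0 < m
        0<m = n≢0⇒n>0 (λ m≡0 → p-no-fixed-point (s 0) (trans p₀≡sₘ (cong s m≡0)))
        s₂ₘ≡s₀ : s (m + m) ≡ s 0
        s₂ₘ≡s₀ = trans (sym (rotation m)) (trans (cong p (sym p₀≡sₘ)) (p-involutive (s 0)))
      ... | inj₂ p₁≡sₘ₋₁ = ⊥-elim (no-partner-reflection s-walk (suc (m + L′))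
              (agree-reversed (p-walk s-walk) s-walk (m + L′) (trans p₀≡sₘ (sym (s-pred m))) p₁≡sₘ₋₁))
    ... | no off = off-cycle off-all
      where
      off₀ : ¬ OnCycle (p (s 0))
      off₀ (j , p₀≡sⱼ) = off (position j , trans p₀≡sⱼ (sym (s-position j)))
      off-all : ∀ k j → p (s k) ≢ s j
      off-all zero    j p₀≡sⱼ = off₀ (j , p₀≡sⱼ)
      off-all (suc k) j pₖ₊₁≡sⱼ with on-cycle-rail (j , pₖ₊₁≡sⱼ) (rail-p (rail-sym (proj₁ (s-walk k))))
      ... | i , pₖ≡sᵢ = off-all k i pₖ≡sᵢ

    module Möbius (m : ℕ) (L≡m+m : L ≡ m + m) (rotation : ∀ k → p (s k) ≡ s (k + m)) where
      everywhere : ∀ y → OnCycle y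
      everywhere = spread OnCycle (0 , refl) closed
        where
        closed : ∀ x y → OnCycle x → x ~ y → OnCycle y
        closed x y (j , refl) sⱼ~y with y ≟ p (s j)
        ... | yes rung = j + m , trans rung (rotation j)
        ... | no  y≢p  = on-cycle-rail (j , refl) (sⱼ~y , y≢p)

      is-partner⇔ : ∀ i j → (s j ≡ p (s i)) ⇔ (+ L ∣ + i ℤ.- + j ℤ.- + m)
      is-partner⇔ i j = ⇔-trans
        (mk⇔ (λ sⱼ≡pᵢ → trans (sym (rotation i)) (sym sⱼ≡pᵢ))
             (λ sᵢ₊ₘ≡sⱼ → trans (sym sᵢ₊ₘ≡sⱼ) (sym (rotation i))))
        (⇔-trans (s-equal⇔ (i + m) j) (shift-half m L≡m+m i j))

      adjacency : ∀ a b → (s (toℕ a) ~ s (toℕ b)) ⇔ HalfTurnAdj L m a b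
      adjacency a b = ⇔-trans (cycle-adjacency (toℕ a) (toℕ b))
                        (⇔-trans (is-partner⇔ (toℕ a) (toℕ b) ⊎-⇔ mk⇔ id id) rotate-⊎)

      iso : Isomorphic Γ (HalfTurnAdj L m)
      iso = labelling⇒iso Γ (HalfTurnAdj L m) (s ∘ toℕ) (position ∘ proj₁ ∘ everywhere)
        (λ y → trans (s-position (proj₁ (everywhere y))) (sym (proj₂ (everywhere y))))
        (λ i → position-unique (proj₁ (everywhere (s (toℕ i)))) i (sym (proj₂ (everywhere (s (toℕ i))))))
        adjacency

    -- If p moves C off itself, C ∪ p C is everything and Γ is the
    -- circular ladder: level 0 is C, level 1 is p C.
    module Circular (off : ∀ k j → p (s k) ≢ s j) where
      everywhere : ∀ y → OnCycle y ⊎ OnCycle (p y)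
      everywhere = spread (λ y → OnCycle y ⊎ OnCycle (p y)) (inj₁ (0 , refl)) closed
        where
        closed : ∀ x y → OnCycle x ⊎ OnCycle (p x) → x ~ y → OnCycle y ⊎ OnCycle (p y)
        closed x y on x~y with y ≟ p x | on
        ... | yes refl | inj₁ onₓ = inj₂ (subst OnCycle (sym (p-involutive x)) onₓ)
        ... | yes refl | inj₂ onₚₓ = inj₁ onₚₓ
        ... | no  y≢p  | inj₁ onₓ = inj₁ (on-cycle-rail onₓ (x~y , y≢p))
        ... | no  y≢p  | inj₂ onₚₓ = inj₂ (on-cycle-rail onₚₓ (rail-p (x~y , y≢p)))

      label : Fin L × Fin 2 → V
      label (i , 0F) = s (toℕ i)
      label (i , 1F) = p (s (toℕ i))

      level-index : ∀ {y} → OnCycle y ⊎ OnCycle (p y) → Fin L × Fin 2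
      level-index (inj₁ (j , _)) = position j , 0F
      level-index (inj₂ (j , _)) = position j , 1F

      label-index : ∀ {y} (on : OnCycle y ⊎ OnCycle (p y)) → label (level-index on) ≡ y
      label-index     (inj₁ (j , y≡sⱼ))  = trans (s-position j) (sym y≡sⱼ)
      label-index {y} (inj₂ (j , py≡sⱼ)) = trans (cong p (trans (s-position j) (sym py≡sⱼ))) (p-involutive y)

      index-label : ∀ b (on : OnCycle (label b) ⊎ OnCycle (p (label b))) → level-index on ≡ b
      index-label (i , 0F) (inj₁ (j , sᵢ≡sⱼ))  = cong (_, 0F) (position-unique j i (sym sᵢ≡sⱼ))
      index-label (i , 0F) (inj₂ (j , pᵢ≡sⱼ))  = ⊥-elim (off (toℕ i) j pᵢ≡sⱼ)
      index-label (i , 1F) (inj₁ (j , pᵢ≡sⱼ))  = ⊥-elim (off (toℕ i) j pᵢ≡sⱼ)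
      index-label (i , 1F) (inj₂ (j , ppᵢ≡sⱼ)) =
        cong (_, 1F) (position-unique j i (sym (trans (sym (p-involutive (s (toℕ i)))) ppᵢ≡sⱼ)))

      rail-adjacency : ∀ i j → (s i ~ s j) ⇔ ((+ L ∣ + i ℤ.- + j ℤ.- + 1) ⊎ (+ L ∣ + i ℤ.- + j ℤ.+ + 1))
      rail-adjacency i j = ⇔-trans (cycle-adjacency i j) (mk⇔ drop-rung inj₂)
        where
        drop-rung : ∀ {A} → s j ≡ p (s i) ⊎ A → A
        drop-rung (inj₁ sⱼ≡pᵢ) = ⊥-elim (off i j (sym sⱼ≡pᵢ))
        drop-rung (inj₂ a)     = a

      rung-adjacency : ∀ i j → (s i ~ p (s j)) ⇔ (s i ≡ s j)
      rung-adjacency i j = mk⇔ to (λ sᵢ≡sⱼ → subst (λ x → s i ~ p x) sᵢ≡sⱼ (x~px (s i)))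
        where
        to : s i ~ p (s j) → s i ≡ s j
        to sᵢ~pⱼ with Equivalence.to (cycle-nbrs i (p (s j))) sᵢ~pⱼ
        ... | inj₁ pⱼ≡pᵢ        = sym (p-injective pⱼ≡pᵢ)
        ... | inj₂ (inj₁ back)  = ⊥-elim (off j (i + L′) back)
        ... | inj₂ (inj₂ fwd)   = ⊥-elim (off j (suc i) fwd)

      p-adjacency : ∀ x y → (p x ~ p y) ⇔ (x ~ y)
      p-adjacency x y = mk⇔ (λ px~py → subst₂ _~_ (p-involutive x) (p-involutive y) (p-adjacent px~py)) p-adjacent

      adjacency : ∀ a b → (label a ~ label b) ⇔ CircularLadderAdj L a b
      adjacency (i , 0F) (j , 0F) =
        ⇔-trans (rail-adjacency (toℕ i) (toℕ j)) (⇔-sym (rails-only 2∤1 2∣0))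
      adjacency (i , 1F) (j , 1F) =
        ⇔-trans (p-adjacency _ _) (⇔-trans (rail-adjacency (toℕ i) (toℕ j)) (⇔-sym (rails-only 2∤1 2∣0)))
      adjacency (i , 0F) (j , 1F) =
        ⇔-trans (rung-adjacency (toℕ i) (toℕ j))
          (⇔-trans (s-equal⇔ (toℕ i) (toℕ j)) (⇔-sym (rung-only 2∣2 2∤1)))
      adjacency (i , 1F) (j , 0F) =
        ⇔-trans (mk⇔ ~-sym ~-sym) (⇔-trans (rung-adjacency (toℕ j) (toℕ i))
          (⇔-trans (mk⇔ sym sym) (⇔-trans (s-equal⇔ (toℕ i) (toℕ j)) (⇔-sym (rung-only 2∣0 2∤1)))))

      iso : Isomorphic Γ (CircularLadderAdj L)
      iso = labelling⇒iso Γ (CircularLadderAdj L) label (level-index ∘ everywhere)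
        (label-index ∘ everywhere) (λ b → index-label b (everywhere (label b))) adjacency

  ladder : (∃[ n ] (3 ≤ n × Isomorphic Γ (CircularLadderAdj n)))
         ⊎ (∃[ n ] (2 ≤ n × Isomorphic Γ (MobiusLadderAdj n)))
  ladder with first-return
  ... | zero , (() , _) , _
  ... | suc L′ , returns , first with Cycle.partner-action L′ returns first
  ...   | Cycle.off-cycle off = inj₁ (suc L′ , returns⇒3≤ returns , Cycle.Circular.iso L′ returns first off)
  ...   | Cycle.half-turn m L≡m+m rotation =
    inj₂ (m , half-of-3≤ m (subst (3 ≤_) L≡m+m (returns⇒3≤ returns)) ,
          subst (λ n → Isomorphic Γ (HalfTurnAdj n m)) (trans L≡m+m (cong (_+_ m) (sym (+-identityʳ m))))
                (Cycle.Möbius.iso L′ returns first m L≡m+m rotation))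

-- Carrying this picture along G gives the rung matching: p x is the
-- neighbour of x fixed by G_x.
module LocalAction (Γ : Graph) (G : Permutation′ (Graph.N Γ) → Set)
  (subgroup : IsAutSubgroup Γ G) (transitive : VertexTransitive Γ G)
  (v₀ a₀ b₀ c₀ : Fin (Graph.N Γ))
  (v₀~a₀ : Graph._~_ Γ v₀ a₀) (v₀~b₀ : Graph._~_ Γ v₀ b₀) (v₀~c₀ : Graph._~_ Γ v₀ c₀)
  (a₀≢b₀ : a₀ ≢ b₀) (a₀≢c₀ : a₀ ≢ c₀) (b₀≢c₀ : b₀ ≢ c₀)
  (neighbours₀ : ∀ w → Graph._~_ Γ v₀ w → w ≡ a₀ ⊎ w ≡ b₀ ⊎ w ≡ c₀)
  (fixes-a₀ : ∀ g → InStab Γ G v₀ g → g ⟨$⟩ʳ a₀ ≡ a₀)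
  (k₀ : Permutation′ (Graph.N Γ)) (k₀-stab : InStab Γ G v₀ k₀)
  (k₀b₀ : k₀ ⟨$⟩ʳ b₀ ≡ c₀) (k₀c₀ : k₀ ⟨$⟩ʳ c₀ ≡ b₀) where
  open Graph Γ renaming (sym to ~-sym)
  open IsAutSubgroup subgroup
  open import Data.Fin using (toℕ; _≟_)
  import Data.Fin.Properties as Fin

  V : Set
  V = Fin N

  infixr 30 _·_
  _·_ : Permutation′ N → V → V
  g · x = g ⟨$⟩ʳ x

  aut-to : ∀ {g} → G g → ∀ {x y} → x ~ y → g · x ~ g · y
  aut-to {g} g∈G {x} {y} = Equivalence.to (aut g g∈G x y)

  aut-from : ∀ {g} → G g → ∀ {x y} → g · x ~ g · y → x ~ y
  aut-from {g} g∈G {x} {y} = Equivalence.from (aut g g∈G x y)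

  ·-injective : ∀ g {x y} → g · x ≡ g · y → x ≡ y
  ·-injective g {x} {y} e = trans (sym (inverseˡ g)) (trans (cong (g ⟨$⟩ˡ_) e) (inverseˡ g))

  unapply : ∀ g {x y} → g · x ≡ y → flip g · y ≡ x
  unapply g refl = inverseˡ g

  carry : V → Permutation′ N
  carry x = proj₁ (transitive v₀ x)

  carry-in-G : ∀ x → G (carry x)
  carry-in-G x = proj₁ (proj₂ (transitive v₀ x))

  carry-v₀ : ∀ x → carry x · v₀ ≡ x
  carry-v₀ x = proj₂ (proj₂ (transitive v₀ x))

  p r₁ r₂ : V → V
  p  x = carry x · a₀
  r₁ x = carry x · b₀
  r₂ x = carry x · c₀

  r₁≢r₂ : ∀ x → r₁ x ≢ r₂ x
  r₁≢r₂ x e = b₀≢c₀ (·-injective (carry x) e)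

  carry-adjacent : ∀ x {w} → v₀ ~ w → x ~ carry x · w
  carry-adjacent x {w} v₀~w = subst (_~ carry x · w) (carry-v₀ x) (aut-to (carry-in-G x) v₀~w)

  neighbours : ∀ x y → x ~ y → y ≡ p x ⊎ y ≡ r₁ x ⊎ y ≡ r₂ x
  neighbours x y x~y = ⊎-map carried (⊎-map carried carried) (neighbours₀ (flip (carry x) · y) v₀~w)
    where
    v₀~w : v₀ ~ flip (carry x) · y
    v₀~w = aut-from (carry-in-G x) (subst₂ _~_ (sym (carry-v₀ x)) (sym (inverseʳ (carry x))) x~y)
    carried : ∀ {w} → flip (carry x) · y ≡ w → y ≡ carry x · w
    carried e = trans (sym (inverseʳ (carry x))) (cong (carry x ·_) e)

  -- Conjugating the stabiliser of x into that of v₀: G_x fixes p x.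
  stabiliser-fixes-p : ∀ x g → InStab Γ G x g → g · p x ≡ p x
  stabiliser-fixes-p x g (g∈G , gx≡x) =
    trans (sym (inverseʳ (carry x))) (cong (carry x ·_) (fixes-a₀ conjugate (conjugate∈G , fixes-v₀)))
    where
    conjugate : Permutation′ N
    conjugate = carry x ∘ₚ (g ∘ₚ flip (carry x))
    conjugate∈G : G conjugate
    conjugate∈G = comp (carry x) _ (carry-in-G x) (comp g _ g∈G (inv (carry x) (carry-in-G x)))
    fixes-v₀ : conjugate · v₀ ≡ v₀
    fixes-v₀ = trans (cong (λ z → flip (carry x) · g · z) (carry-v₀ x))
                 (trans (cong (flip (carry x) ·_) gx≡x) (unapply (carry x) (carry-v₀ x)))

  swap : V → Permutation′ N
  swap x = flip (carry x) ∘ₚ (k₀ ∘ₚ carry x)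

  swap-stab : ∀ x → InStab Γ G x (swap x)
  swap-stab x = comp _ _ (inv (carry x) (carry-in-G x)) (comp k₀ (carry x) (proj₁ k₀-stab) (carry-in-G x))
              , trans (cong (λ z → carry x · k₀ · z) (unapply (carry x) (carry-v₀ x)))
                      (trans (cong (carry x ·_) (proj₂ k₀-stab)) (carry-v₀ x))

  swap-r₁ : ∀ x → swap x · r₁ x ≡ r₂ x
  swap-r₁ x = trans (cong (λ z → carry x · k₀ · z) (inverseˡ (carry x))) (cong (carry x ·_) k₀b₀)

  swap-r₂ : ∀ x → swap x · r₂ x ≡ r₁ x
  swap-r₂ x = trans (cong (λ z → carry x · k₀ · z) (inverseˡ (carry x))) (cong (carry x ·_) k₀c₀)

  fixed-neighbour-unique : ∀ x y → x ~ y → (∀ g → InStab Γ G x g → g · y ≡ y) → y ≡ p x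
  fixed-neighbour-unique x y x~y fixed with neighbours x y x~y
  ... | inj₁ y≡px        = y≡px
  ... | inj₂ (inj₁ refl) = ⊥-elim (r₁≢r₂ x (sym (trans (sym (swap-r₁ x)) (fixed (swap x) (swap-stab x)))))
  ... | inj₂ (inj₂ refl) = ⊥-elim (r₁≢r₂ x (trans (sym (swap-r₂ x)) (fixed (swap x) (swap-stab x))))

  p-equivariant : ∀ g → G g → ∀ x → g · p x ≡ p (g · x)
  p-equivariant g g∈G x = fixed-neighbour-unique (g · x) (g · p x) (aut-to g∈G (carry-adjacent x v₀~a₀)) fixed
    where
    fixed : ∀ k → InStab Γ G (g · x) k → k · g · p x ≡ g · p x
    fixed k (k∈G , kgx≡gx) =
      trans (sym (inverseʳ g)) (cong (g ·_) (stabiliser-fixes-p x conjugate (conjugate∈G , fixes-x)))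
      where
      conjugate : Permutation′ N
      conjugate = g ∘ₚ (k ∘ₚ flip g)
      conjugate∈G : G conjugate
      conjugate∈G = comp g _ g∈G (comp k _ k∈G (inv g g∈G))
      fixes-x : conjugate · x ≡ x
      fixes-x = trans (cong (flip g ·_) kgx≡gx) (inverseˡ g)

  -- Along the orbit v₀, p v₀, p² v₀, … stabilisers
  -- grow (G_x fixes p x); by finiteness the orbit returns, which yields a
  -- vertex y with G_{p y} ≤ G_y, so y is the fixed neighbour of p y.
  orbit : ℕ → V
  orbit zero    = v₀
  orbit (suc k) = p (orbit k)

  orbit-fixed : ∀ a g → InStab Γ G (orbit (suc a)) g → ∀ d → g · orbit (d + suc a) ≡ orbit (d + suc a)
  orbit-fixed a g stab zero    = proj₂ stab
  orbit-fixed a g stab (suc d) = stabiliser-fixes-p _ g (proj₁ stab , orbit-fixed a g stab d)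

  involutive-somewhere : ∃ λ y → p (p y) ≡ y
  involutive-somewhere with Fin.pigeonhole (n<1+n N) (λ i → orbit (toℕ i))
  ... | i , j , i<j , orbitᵢ≡orbitⱼ =
    orbit (toℕ i) , sym (fixed-neighbour-unique _ _ (~-sym (carry-adjacent (orbit (toℕ i)) v₀~a₀)) fixed)
    where
    fixed : ∀ g → InStab Γ G (orbit (suc (toℕ i))) g → g · orbit (toℕ i) ≡ orbit (toℕ i)
    fixed g stab = subst (λ z → g · z ≡ z) (sym orbitᵢ≡orbitⱼ)
      (subst (λ n → g · orbit n ≡ orbit n) (m∸n+n≡m i<j)
             (orbit-fixed (toℕ i) g stab (toℕ j ∸ suc (toℕ i))))

  p-involutive : ∀ x → p (p x) ≡ x
  p-involutive x with involutive-somewhere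
  ... | y , ppy≡y with transitive y x
  ...   | g , g∈G , refl = trans (cong p (sym (p-equivariant g g∈G y)))
                             (trans (sym (p-equivariant g g∈G (p y))) (cong (g ·_) ppy≡y))

  rungs : RungMatching Γ
  rungs = record
    { p            = p
    ; p-involutive = p-involutive
    ; x~px         = λ x → carry-adjacent x v₀~a₀
    ; r₁           = r₁
    ; r₂           = r₂
    ; x~r₁x        = λ x → carry-adjacent x v₀~b₀
    ; x~r₂x        = λ x → carry-adjacent x v₀~c₀
    ; r₁≢r₂        = r₁≢r₂
    ; r₁≢p         = λ x e → a₀≢b₀ (sym (·-injective (carry x) e))
    ; r₂≢p         = λ x e → a₀≢c₀ (sym (·-injective (carry x) e))
    ; neighbours   = neighbours
    }

  open Rails Γ rungs
    using (Rail; PreservesRails; rail-cases; rail-two; rail-sym; rail-irrefl; p-injective; p-no-fixed-point)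

  rail-image : ∀ {g} → G g → ∀ {x z} → Rail x z → Rail (g · x) (g · z)
  rail-image {g} g∈G {x} (x~z , z≢px) =
    aut-to g∈G x~z , λ gz≡pgx → z≢px (·-injective g (trans gz≡pgx (sym (p-equivariant g g∈G x))))

  rail-preimage : ∀ {g} → G g → ∀ {x z} → Rail (g · x) z → Rail x (flip g · z)
  rail-preimage {g} g∈G {x} {z} rail = subst (λ y → Rail y (flip g · z)) (inverseˡ g) (rail-image (inv g g∈G) rail)

  swap-rail : ∀ {x z} → Rail x z → Rail x (swap x · z) × swap x · z ≢ z
  swap-rail {x} {z} rail =
    subst (λ y → Rail y (swap x · z)) (proj₂ (swap-stab x)) (rail-image (proj₁ (swap-stab x)) rail) ,
    moved (rail-cases rail)
    where
    moved : z ≡ r₁ x ⊎ z ≡ r₂ x → swap x · z ≢ z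
    moved (inj₁ refl) e = r₁≢r₂ x (trans (sym e) (swap-r₁ x))
    moved (inj₂ refl) e = r₁≢r₂ x (trans (sym (swap-r₂ x)) e)

  everywhere : (P : V → Set) → (∀ g x → G g → P x → P (g · x)) → ∀ {u} → P u → ∀ x → P x
  everywhere P invariant {u} pᵤ x with transitive u x
  ... | g , g∈G , refl = invariant g u g∈G pᵤ

  PreservesRailsAt : V → Set
  PreservesRailsAt x = ∀ {z} → Rail x z → p x ~ p z

  preserves-invariant : ∀ g x → G g → PreservesRailsAt x → PreservesRailsAt (g · x)
  preserves-invariant g x g∈G at {z} rail =
    subst₂ _~_ (p-equivariant g g∈G x) (trans (p-equivariant g g∈G (flip g · z)) (cong p (inverseʳ g)))
      (aut-to g∈G (at (rail-preimage g∈G rail)))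

  -- If p maps one rail at x to an edge it maps both: swap x exchanges them.
  preserves-from-one : ∀ {x v} → Rail x v → p x ~ p v → PreservesRailsAt x
  preserves-from-one {x} {v} rail-v pₓ~pᵥ rail-z
    with rail-two rail-v (proj₁ (swap-rail rail-v)) (λ e → proj₂ (swap-rail rail-v) (sym e)) rail-z
  ... | inj₁ refl = pₓ~pᵥ
  ... | inj₂ refl = subst₂ _~_ (stabiliser-fixes-p x (swap x) (swap-stab x)) (p-equivariant (swap x) swap∈G v)
                      (aut-to swap∈G pₓ~pᵥ)
    where
    swap∈G : G (swap x)
    swap∈G = proj₁ (swap-stab x)

  RailsAdjacentAt : V → Set
  RailsAdjacentAt x = ∀ {z₁ z₂} → Rail x z₁ → Rail x z₂ → z₁ ≢ z₂ → z₁ ~ z₂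

  adjacent-invariant : ∀ g x → G g → RailsAdjacentAt x → RailsAdjacentAt (g · x)
  adjacent-invariant g x g∈G at rail₁ rail₂ z₁≢z₂ = subst₂ _~_ (inverseʳ g) (inverseʳ g)
    (aut-to g∈G (at (rail-preimage g∈G rail₁) (rail-preimage g∈G rail₂)
                    (λ e → z₁≢z₂ (·-injective (flip g) e))))

  -- A triangle on a rung: if a is adjacent to both b and p b, then the
  -- rails at a end in the rung {b, p b}, so the two rail neighbours of
  -- every vertex are adjacent.  At b, swap b sends a to the other rail
  -- neighbour w, and w ~ a forces w = p a; applying swap b to p b ~ a
  -- then gives p b ~ p a.
  triangle⇒preserves : ∀ {a b} → a ~ b → a ~ p b → ∀ x → PreservesRailsAt x
  triangle⇒preserves {a} {b} a~b a~pb = everywhere PreservesRailsAt preserves-invariant (preserves-from-one rail-ba pb~pa)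
    where
    rail-ab : Rail a b
    rail-ab = a~b , λ b≡pa → irrefl (subst (a ~_) (trans (cong p b≡pa) (p-involutive a)) a~pb)
    rail-apb : Rail a (p b)
    rail-apb = a~pb , λ pb≡pa → irrefl (subst (a ~_) (p-injective pb≡pa) a~b)
    b≢pb : b ≢ p b
    b≢pb b≡pb = p-no-fixed-point b (sym b≡pb)
    rail-ba : Rail b a
    rail-ba = rail-sym rail-ab
    adjacent-at-a : RailsAdjacentAt a
    adjacent-at-a rail₁ rail₂ z₁≢z₂
      with rail-two rail-ab rail-apb b≢pb rail₁ | rail-two rail-ab rail-apb b≢pb rail₂
    ... | inj₁ refl | inj₁ refl = ⊥-elim (z₁≢z₂ refl)
    ... | inj₁ refl | inj₂ refl = carry-adjacent b v₀~a₀
    ... | inj₂ refl | inj₁ refl = ~-sym (carry-adjacent b v₀~a₀)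
    ... | inj₂ refl | inj₂ refl = ⊥-elim (z₁≢z₂ refl)
    rail-bw : Rail b (swap b · a)
    rail-bw = proj₁ (swap-rail rail-ba)
    a~w : a ~ swap b · a
    a~w = everywhere RailsAdjacentAt adjacent-invariant adjacent-at-a b rail-ba rail-bw
            (λ e → proj₂ (swap-rail rail-ba) (sym e))
    w≡pa : swap b · a ≡ p a
    w≡pa with swap b · a ≟ p a
    ... | yes w≡pa = w≡pa
    ... | no  w≢pa with rail-two rail-ab rail-apb b≢pb (a~w , w≢pa)
    ...   | inj₁ w≡b  = ⊥-elim (rail-irrefl rail-bw (sym w≡b))
    ...   | inj₂ w≡pb = ⊥-elim (proj₂ rail-bw w≡pb)
    pb~pa : p b ~ p a
    pb~pa = subst₂ _~_ (stabiliser-fixes-p b (swap b) (swap-stab b)) w≡pa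
              (aut-to (proj₁ (swap-stab b)) (~-sym a~pb))

  partner-of : ∀ {u u′} → FixedNbr Γ G u u′ → u′ ≡ p u
  partner-of {u} {u′} (u~u′ , fixed) = fixed-neighbour-unique u u′ u~u′ fixed

  same-rung : ∀ {u x₁ x₂} → InPair Γ G x₁ u (p u) → InPair Γ G x₂ u (p u) →
              x₂ ≡ x₁ ⊎ x₂ ≡ p x₁
  same-rung     (inj₁ refl) (inj₁ refl) = inj₁ refl
  same-rung     (inj₁ refl) (inj₂ refl) = inj₂ refl
  same-rung {u} (inj₂ refl) (inj₁ refl) = inj₂ (sym (p-involutive u))
  same-rung     (inj₂ refl) (inj₂ refl) = inj₁ refl

  cross-not-rung : ∀ {u v x y} → ¬ SameSet Γ G u (p u) v (p v) →
                   InPair Γ G x u (p u) → InPair Γ G y v (p v) → y ≢ p x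
  cross-not-rung {u} different (inj₁ refl) (inj₁ refl) v≡pu =
    different (inj₂ (trans (sym (p-involutive u)) (cong p (sym v≡pu)) , sym v≡pu))
  cross-not-rung different (inj₁ refl) (inj₂ refl) pv≡pu =
    different (inj₁ (sym (p-injective pv≡pu) , sym pv≡pu))
  cross-not-rung {u} different (inj₂ refl) (inj₁ refl) v≡ppu =
    different (inj₁ (sym (trans v≡ppu (p-involutive u)) , cong p (sym (trans v≡ppu (p-involutive u)))))
  cross-not-rung {u} different (inj₂ refl) (inj₂ refl) pv≡ppu =
    different (inj₂ (trans (sym (p-involutive u)) (cong p (sym (p-injective pv≡ppu))) , sym (p-injective pv≡ppu)))

  -- In a degenerate configuration the two edges between the rungs either
  -- share an endpoint, giving a triangle on a rung, or together with the
  -- rungs form a 4-cycle, on which p maps a rail to an edge.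
  degenerate⇒preserves : Degenerate Γ G → PreservesRails
  degenerate⇒preserves
    (u , u′ , v , v′ , fixed-u , fixed-v , different ,
     x₁ , y₁ , x₂ , y₂ , x₁∈ , y₁∈ , x₁~y₁ , x₂∈ , y₂∈ , x₂~y₂ , distinct)
    with partner-of fixed-u | partner-of fixed-v
  ... | refl | refl with same-rung x₁∈ x₂∈ | same-rung y₁∈ y₂∈
  ...   | inj₁ refl | inj₁ refl = ⊥-elim (distinct (inj₁ (refl , refl)))
  ...   | inj₁ refl | inj₂ refl = triangle⇒preserves x₁~y₁ x₂~y₂ _
  ...   | inj₂ refl | inj₁ refl = triangle⇒preserves (~-sym x₁~y₁) (~-sym x₂~y₂) _
  ...   | inj₂ refl | inj₂ refl =
    everywhere PreservesRailsAt preserves-invariant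
      (preserves-from-one (x₁~y₁ , cross-not-rung different x₁∈ y₁∈) x₂~y₂) _

lemma4p5 : (Γ : Graph) → Cubic Γ → Connected Γ →
    (G : Permutation′ (Graph.N Γ) → Set) →
    IsAutSubgroup Γ G → VertexTransitive Γ G → LocallyZ2on3 Γ G →
    Degenerate Γ G →
    (∃[ n ] (3 ≤ n × Isomorphic Γ (CircularLadderAdj n)))
      ⊎ (∃[ n ] (2 ≤ n × Isomorphic Γ (MobiusLadderAdj n)))
lemma4p5 Γ _ connected G subgroup transitive
  (v₀ , a₀ , b₀ , c₀ , v₀~a₀ , v₀~b₀ , v₀~c₀ , a₀≢b₀ , a₀≢c₀ , b₀≢c₀ ,
   neighbours₀ , stabiliser₀ , k₀ , k₀-stab , k₀b₀ , k₀c₀) degenerate =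
  Classification.ladder Γ rungs (degenerate⇒preserves degenerate) connected v₀
  where
  open LocalAction Γ G subgroup transitive v₀ a₀ b₀ c₀ v₀~a₀ v₀~b₀ v₀~c₀ a₀≢b₀ a₀≢c₀ b₀≢c₀
         neighbours₀ (λ g g∈G_v₀ → proj₁ (stabiliser₀ g g∈G_v₀)) k₀ k₀-stab k₀b₀ k₀c₀
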